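{- Let $\Sigma$ be a finite set of primes and let $a_1,\ldots,a_k,b_1,\ldots,b_k$ be integers with $a_i\neq0$, $\gcd(a_i,b_i)=1$ for all $i$, and $a_ib_j-a_jb_i\neq0$ for $1\le i<j\le k$, such that $(2k)!\prod_{i}a_i\prod_{i<j}(a_ib_j-a_jb_i)$ is a $\Sigma$-unit. Put $L_i(n)=a_in+b_i$ and $M=\max\{|a_1|,\ldots,|a_k|,|b_1|,\ldots,|b_k|\}$. Then for all real $x\ge z\ge2$ the set $\Omega(x,z)$ has at most $$kM\frac{x+1}{z-1}+k\sqrt{Mx+M}$$ elements $n$ such that $L_i(n)$ is not $\Sigma$-square-free for some $i$.
   Context: An integer is a $\Sigma$-unit if all its prime divisors belong to $\Sigma$, and $\Sigma$-square-free if it is the product of a $\Sigma$-unit and a square-free integer. For real $z\ge2$, $P_\Sigma(z)=\prod_{p<z,\,p\notin\Sigma}p$. For real $x\ge z\ge2$, $\Omega(x,z)=\{n\in\mathbb{Z}:1\le n\le x,\ \gcd(L_1(n)\cdots L_k(n),P_\Sigma(z))=1\}$.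
   Formalization: The parameters x and z with $x\ge z\ge2$ range over the rationals rather than the reals. -}

module Defs where

open import Data.Nat as ℕ using (ℕ; suc; _!)
open import Data.Nat.Primality using (Prime; prime?)
open import Data.Integer as ℤ using (ℤ; +_; ∣_∣)
open import Data.Integer.Divisibility using () renaming (_∣_ to _∣ℤ_)
open import Data.Integer.GCD using () renaming (gcd to gcdℤ)
open import Data.Rational as ℚ using (ℚ; floor; 0ℚ)
open import Data.Rational.Properties using (_<?_)
open import Data.Fin using (Fin; _<_)
open import Data.List using (List; []; _∷_; foldr; map; allFin; upTo; filter)
open import Data.List.Membership.Propositional using (_∈_; _∉_)
open import Data.List.Membership.DecPropositional ℕ._≟_ using (_∈?_)
open import Data.List.Relation.Unary.All using (All)
open import Data.List.Relation.Unary.Unique.Propositional using (Unique)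
open import Data.Product using (Σ; _×_; ∃; ∃-syntax)
open import Data.Sum using (_⊎_)
open import Relation.Nullary using (¬_)
open import Relation.Nullary.Decidable using (_×-dec_; ¬?)
open import Relation.Binary.PropositionalEquality using (_≡_)

-- Σ is represented by a list of natural numbers, all of which are prime.
-- an integer m is a Σ-unit if every prime divisor of m lies in Σ
IsΣUnit : List ℕ → ℤ → Set
IsΣUnit Σs m = ∀ (p : ℕ) → Prime p → (+ p) ∣ℤ m → p ∈ Σs

SquareFree : ℤ → Set
SquareFree s = ∀ (d : ℤ) → (d ℤ.* d) ∣ℤ s → ∣ d ∣ ≡ 1

IsΣSquareFree : List ℕ → ℤ → Set
IsΣSquareFree Σs m = ∃[ u ] ∃[ s ] (IsΣUnit Σs u × SquareFree s × m ≡ u ℤ.* s)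

ℤtoℚ : ℤ → ℚ
ℤtoℚ i = i ℚ./ 1

ℕtoℚ : ℕ → ℚ
ℕtoℚ n = ℤtoℚ (+ n)

-- P_Σ(z) = product of the primes p < z with p ∉ Σ
-- (all such p satisfy p ≤ floor z, so the candidates 0..floor z suffice)
PΣ : List ℕ → ℚ → ℕ
PΣ Σs z = foldr ℕ._*_ 1
  (filter (λ p → prime? p ×-dec ¬? (p ∈? Σs) ×-dec (ℕtoℚ p <? z))
          (upTo (suc ∣ floor z ∣)))

prodFin : ∀ {k} → (Fin k → ℤ) → ℤ
prodFin {k} f = foldr ℤ._*_ (ℤ.+ 1) (map f (allFin k))

prodPairs : ∀ {k} → (Fin k → Fin k → ℤ) → ℤ
prodPairs {k} f = prodFin (λ i → prodFin (λ j → pairTerm i j))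
  where
  pairTerm : Fin k → Fin k → ℤ
  pairTerm i j with i Data.Fin.<? j
  ... | Relation.Nullary.yes _ = f i j
  ... | Relation.Nullary.no _  = ℤ.+ 1

maxFin : ∀ {k} → (Fin k → ℕ) → ℕ
maxFin {k} f = foldr ℕ._⊔_ 0 (map f (allFin k))

Lform : ∀ {k} → (Fin k → ℤ) → (Fin k → ℤ) → Fin k → ℤ → ℤ
Lform a b i n = a i ℤ.* n ℤ.+ b i

InΩ : List ℕ → ∀ {k} → (Fin k → ℤ) → (Fin k → ℤ) → ℚ → ℚ → ℤ → Set
InΩ Σs a b x z n =
  (ℤ.+ 1 ℤ.≤ n) × (ℤtoℚ n ℚ.≤ x) ×
  (gcdℤ (prodFin (λ i → Lform a b i n)) (+ PΣ Σs z) ≡ ℤ.+ 1)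

-- "y ≤ c · √b" for c ≥ 0 and b ≥ 0, written without square roots:
-- either y ≤ 0, or y² ≤ c² b.
LeMulSqrt : ℚ → ℚ → ℚ → Set
LeMulSqrt y c b = (y ℚ.≤ 0ℚ) ⊎ (y ℚ.* y ℚ.≤ c ℚ.* c ℚ.* b)

module Submission where

-- Let n ∈ Ω(x,z) with L_i(n) not Σ-square-free.  Then L_i(n) = 0, which happens
-- for at most one n as a_i ≠ 0, or p² ∣ L_i(n) for a prime p ∉ Σ.  Such a p does not
-- divide P_Σ(z) (n ∈ Ω), so p ≥ Z := ⌈z⌉; also p² ≤ |L_i(n)| ≤ V := M(X+1), where X is
-- the largest n counted; and p is prime to a_i since a_i divides the Σ-unit of the
-- hypothesis.  For fixed i and d prime to a_i, the n ∈ [1,X] with d² ∣ L_i(n) form one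
-- residue class mod d², hence number at most ⌊X/d²⌋ + 1.  Summing over the E moduli
-- Z ≤ d with d² ≤ V gives N ≤ k(S + E + 1), where S = Σ ⌊X/d²⌋ satisfies S(Z-1) ≤ X
-- (telescoping 1/d² ≤ 1/(d-1) − 1/d) and (E+1)² ≤ V.  Rearranged over ℚ this is
-- N(z-1) − kM(x+1) ≤ k(z-1)√(M(x+1)), stated without roots as LeMulSqrt.

open import Defs
open import Data.Nat as ℕ using (ℕ; zero; suc; _≤_; z≤n; s≤s; _!; _⊔_; NonZero)
import Data.Nat.Properties as ℕP
import Data.Nat.Coprimality as Cop
open import Data.Nat.Divisibility as ℕD using (_∣_; _∣?_)
open import Data.Nat.DivMod using (_/_; _%_; m≡m%n+[m/n]*n; m/n*n≤m; m%n<n; /-monoˡ-≤)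
open import Data.Nat.Primality using (Prime; prime?; prime⇒irreducible; prime⇒nonZero; euclidsLemma)
open import Data.Nat.Primality.Factorisation using (factorise)
open import Data.Nat.ListAction using (sum; product)
open import Data.Nat.ListAction.Properties using (∈⇒∣product)
open import Data.Nat.Induction using (<-wellFounded)
import Data.Nat.Tactic.RingSolver as ℕSolver
open import Data.Integer as ℤ using (ℤ; +_; -[1+_]; ∣_∣; 0ℤ)
import Data.Integer.Properties as ℤP
import Data.Integer.DivMod as ℤD
import Data.Integer.Divisibility.Signed as ℤS
open import Data.Integer.GCD using () renaming (gcd to gcdℤ)
import Data.Integer.GCD as ℤG
open import Data.Integer.Tactic.RingSolver using (solve-∀)
open import Data.Rational as ℚ using (ℚ; mkℚ; floor; 0ℚ)
import Data.Rational.Properties as ℚP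
open import Data.Rational.Solver using (module +-*-Solver)
open import Data.Fin as Fin using (Fin; _<_; toℕ; fromℕ<)
import Data.Fin.Properties as FinP
open import Data.List using (List; []; _∷_; foldr; map; allFin; upTo; filter; length; lookup)
open import Data.List.Properties using (filter-accept; length-tabulate)
open import Data.List.Relation.Unary.All as All using (All; []; _∷_)
import Data.List.Relation.Unary.All.Properties as AllP
open import Data.List.Relation.Unary.All.Properties using (all-filter)
open import Data.List.Relation.Unary.Any as Any using (Any; here; there; any?)
open import Data.List.Relation.Unary.AllPairs using ([]; _∷_)
open import Data.List.Relation.Unary.Unique.Propositional using (Unique)
import Data.List.Relation.Unary.Unique.Propositional.Properties as UniqP
open import Data.List.Membership.Propositional using (_∈_; _∉_; find; lose)
open import Data.List.Membership.Propositional.Properties using (∈-filter⁺; ∈-map⁺; ∈-upTo⁺; ∈-allFin; ∈-lookup)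
open import Data.List.Membership.DecPropositional ℕ._≟_ using (_∈?_)
open import Data.Product using (_×_; _,_; ∃-syntax; proj₁; proj₂)
open import Data.Sum using (_⊎_; inj₁; inj₂)
open import Data.Empty using (⊥; ⊥-elim)
open import Relation.Nullary using (¬_; Dec; yes; no)
open import Relation.Nullary.Decidable using (_×-dec_; ¬?)
open import Relation.Unary using (Decidable)
open import Relation.Binary.PropositionalEquality
open import Induction.WellFounded using (Acc; acc)
open import Algebra.Bundles using (AbelianGroup)
open import Algebra.Properties.Group (AbelianGroup.group ℤP.+-0-abelianGroup) using () renaming (∙-cancelʳ to +-cancelʳ)

ℤtoℚ-mkℚ : ∀ i → ℤtoℚ i ≡ mkℚ i 0 (Cop.sym (Cop.1-coprimeTo ∣ i ∣))
ℤtoℚ-mkℚ (+ n)    = ℚP.normalize-coprime (Cop.sym (Cop.1-coprimeTo n))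
ℤtoℚ-mkℚ -[1+ n ] = cong ℚ.-_ (ℚP.normalize-coprime (Cop.sym (Cop.1-coprimeTo (suc n))))

ℤtoℚ-+ : ∀ i j → ℤtoℚ (i ℤ.+ j) ≡ ℤtoℚ i ℚ.+ ℤtoℚ j
ℤtoℚ-+ i j rewrite ℤtoℚ-mkℚ i | ℤtoℚ-mkℚ j | ℤP.*-identityʳ i | ℤP.*-identityʳ j = refl

ℤtoℚ-* : ∀ i j → ℤtoℚ (i ℤ.* j) ≡ ℤtoℚ i ℚ.* ℤtoℚ j
ℤtoℚ-* i j rewrite ℤtoℚ-mkℚ i | ℤtoℚ-mkℚ j = refl

ℤtoℚ-mono-≤ : ∀ {i j} → i ℤ.≤ j → ℤtoℚ i ℚ.≤ ℤtoℚ j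
ℤtoℚ-mono-≤ {i} {j} i≤j rewrite ℤtoℚ-mkℚ i | ℤtoℚ-mkℚ j =
  ℚ.*≤* (subst₂ ℤ._≤_ (sym (ℤP.*-identityʳ i)) (sym (ℤP.*-identityʳ j)) i≤j)

ℤtoℚ-cancel-≤ : ∀ {i j} → ℤtoℚ i ℚ.≤ ℤtoℚ j → i ℤ.≤ j
ℤtoℚ-cancel-≤ {i} {j} i≤j rewrite ℤtoℚ-mkℚ i | ℤtoℚ-mkℚ j with i≤j
... | ℚ.*≤* le = subst₂ ℤ._≤_ (ℤP.*-identityʳ i) (ℤP.*-identityʳ j) le

ℤtoℚ-cancel-< : ∀ {i j} → ℤtoℚ i ℚ.< ℤtoℚ j → i ℤ.< j
ℤtoℚ-cancel-< {i} {j} i<j rewrite ℤtoℚ-mkℚ i | ℤtoℚ-mkℚ j with i<j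
... | ℚ.*<* lt = subst₂ ℤ._<_ (ℤP.*-identityʳ i) (ℤP.*-identityʳ j) lt

ℕtoℚ-+ : ∀ m n → ℕtoℚ (m ℕ.+ n) ≡ ℕtoℚ m ℚ.+ ℕtoℚ n
ℕtoℚ-+ m n = ℤtoℚ-+ (+ m) (+ n)

ℕtoℚ-* : ∀ m n → ℕtoℚ (m ℕ.* n) ≡ ℕtoℚ m ℚ.* ℕtoℚ n
ℕtoℚ-* m n = trans (cong ℤtoℚ (ℤP.pos-* m n)) (ℤtoℚ-* (+ m) (+ n))

ℕtoℚ-mono-≤ : ∀ {m n} → m ≤ n → ℕtoℚ m ℚ.≤ ℕtoℚ n
ℕtoℚ-mono-≤ {m} {n} m≤n = ℤtoℚ-mono-≤ {+ m} {+ n} (ℤ.+≤+ m≤n)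

ℕtoℚ-cancel-≤ : ∀ {m n} → ℕtoℚ m ℚ.≤ ℕtoℚ n → m ≤ n
ℕtoℚ-cancel-≤ {m} {n} m≤n = ℤP.drop‿+≤+ (ℤtoℚ-cancel-≤ {+ m} {+ n} m≤n)

ℕtoℚ-nonNeg : ∀ n → 0ℚ ℚ.≤ ℕtoℚ n
ℕtoℚ-nonNeg n = ℕtoℚ-mono-≤ {0} {n} z≤n

ℕtoℚ-pred : ∀ {Z} → 1 ≤ Z → ℕtoℚ (Z ℕ.∸ 1) ≡ ℕtoℚ Z ℚ.- ℕtoℚ 1
ℕtoℚ-pred {Z} 1≤Z = begin
  ℕtoℚ (Z ℕ.∸ 1)                             ≡⟨ solve 2 (λ a o → a := a :+ o :- o) refl (ℕtoℚ (Z ℕ.∸ 1)) (ℕtoℚ 1) ⟩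
  ℕtoℚ (Z ℕ.∸ 1) ℚ.+ ℕtoℚ 1 ℚ.- ℕtoℚ 1       ≡⟨ cong (ℚ._- ℕtoℚ 1) (sym (ℕtoℚ-+ (Z ℕ.∸ 1) 1)) ⟩
  ℕtoℚ (Z ℕ.∸ 1 ℕ.+ 1) ℚ.- ℕtoℚ 1            ≡⟨ cong (λ t → ℕtoℚ t ℚ.- ℕtoℚ 1) (ℕP.m∸n+n≡m 1≤Z) ⟩
  ℕtoℚ Z ℚ.- ℕtoℚ 1                          ∎
  where
  open ≡-Reasoning
  open +-*-Solver

floor-≤ : ∀ q → ℤtoℚ (floor q) ℚ.≤ q
floor-≤ q@(mkℚ n d _) rewrite ℤtoℚ-mkℚ (floor q) =
  ℚ.*≤* (subst (floor q ℤ.* + suc d ℤ.≤_) (sym (ℤP.*-identityʳ n)) (ℤD.[n/d]*d≤n n (+ suc d)))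

<floor+1 : ∀ q → q ℚ.< ℤtoℚ (floor q ℤ.+ + 1)
<floor+1 q@(mkℚ n d _) rewrite ℤtoℚ-mkℚ (floor q ℤ.+ + 1) =
  ℚ.*<* (subst₂ ℤ._<_ (sym (ℤP.*-identityʳ n)) (cong (ℤ._* + suc d) floor+1)
                      (ℤD.n<s[n/ℕd]*d n (suc d)))
  where
  floor+1 : + 1 ℤ.+ n ℤD./ℕ suc d ≡ floor q ℤ.+ + 1
  floor+1 = trans (ℤP.+-comm (+ 1) (n ℤD./ℕ suc d))
                  (cong (ℤ._+ + 1) (sym (ℤD.div-pos-is-/ℕ n (suc d))))

natBelowFloor : ∀ p q → ℕtoℚ p ℚ.≤ q → ∃[ F ] (floor q ≡ + F × p ≤ F)
natBelowFloor p q p≤q = below (floor q) refl (ℤtoℚ-cancel-< (ℚP.≤-<-trans p≤q (<floor+1 q)))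
  where
  below : ∀ f → floor q ≡ f → + p ℤ.< f ℤ.+ + 1 → ∃[ F ] (floor q ≡ + F × p ≤ F)
  below (+ F)           e (ℤ.+<+ p<F+1) = F , e , ℕP.≤-pred (subst (p ℕ.<_) (ℕP.+-comm F 1) p<F+1)
  below -[1+ zero ]     e (ℤ.+<+ ())
  below -[1+ suc _ ]    e ()

record LeastNatAbove (q : ℚ) : Set where
  field
    value : ℕ
    above : q ℚ.≤ ℕtoℚ value
    least : ∀ d → q ℚ.≤ ℕtoℚ d → value ≤ d

leastNatAbove : ∀ q → 0ℚ ℚ.≤ q → LeastNatAbove q
leastNatAbove q 0≤q with natBelowFloor 0 q 0≤q
... | F , floor≡F , _ with ℕtoℚ F ℚP.≟ q
...   | yes F≡q = record
  { value = F
  ; above = ℚP.≤-reflexive (sym F≡q)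
  ; least = λ d q≤d → ℕtoℚ-cancel-≤ (ℚP.≤-trans F≤q q≤d) }
  where
  F≤q : ℕtoℚ F ℚ.≤ q
  F≤q = subst (λ t → ℤtoℚ t ℚ.≤ q) floor≡F (floor-≤ q)
...   | no F≢q = record
  { value = suc F
  ; above = ℚP.<⇒≤ q<F+1
  ; least = least }
  where
  F≤q : ℕtoℚ F ℚ.≤ q
  F≤q = subst (λ t → ℤtoℚ t ℚ.≤ q) floor≡F (floor-≤ q)
  q<F+1 : q ℚ.< ℕtoℚ (suc F)
  q<F+1 = subst (λ t → q ℚ.< ℤtoℚ t)
                (trans (cong (ℤ._+ + 1) floor≡F) (cong +_ (ℕP.+-comm F 1))) (<floor+1 q)
  least : ∀ d → q ℚ.≤ ℕtoℚ d → suc F ≤ d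
  least d q≤d with ℕP.m≤n⇒m<n∨m≡n (ℕtoℚ-cancel-≤ (ℚP.≤-trans F≤q q≤d))
  ... | inj₁ F<d  = F<d
  ... | inj₂ refl = ⊥-elim (F≢q (ℚP.≤-antisym F≤q q≤d))

prime≥2 : ∀ {p} → Prime p → 2 ≤ p
prime≥2 {suc (suc _)} _ = s≤s (s≤s z≤n)

prime∤1 : ∀ {p} → Prime p → ¬ (p ∣ 1)
prime∤1 pp p∣1 = ℕP.<⇒≢ (prime≥2 pp) (sym (ℕD.∣1⇒≡1 p∣1))

prime∣prime : ∀ {r p} → Prime r → Prime p → r ∣ p → r ≡ p
prime∣prime pr pp r∣p with prime⇒irreducible pp r∣p
... | inj₁ refl = ⊥-elim (prime∤1 pr ℕD.∣-refl)
... | inj₂ r≡p  = r≡p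

primeFactor : ∀ n → 2 ≤ n → ∃[ p ] (Prime p × p ∣ n)
primeFactor 0 ()
primeFactor 1 (s≤s ())
primeFactor n@(suc (suc _)) _ with factorise n
... | record { factors = p ∷ ps ; isFactorisation = n≡∏ ; factorsPrime = pp ∷ _ } =
  p , pp , subst (p ∣_) (sym n≡∏) (ℕD.m∣m*n (product ps))

IsΣUnit-1 : ∀ Σs → IsΣUnit Σs (+ 1)
IsΣUnit-1 Σs p pp p∣1 = ⊥-elim (prime∤1 pp p∣1)

IsΣUnit-*prime : ∀ {Σs p u} → p ∈ Σs → Prime p → IsΣUnit Σs u → IsΣUnit Σs (+ p ℤ.* u)
IsΣUnit-*prime {Σs} {p} {u} p∈Σ pp unit r pr r∣pu
  with euclidsLemma p ∣ u ∣ pr (subst (r ∣_) (ℤP.abs-* (+ p) u) r∣pu)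
... | inj₁ r∣p = subst (_∈ Σs) (sym (prime∣prime pr pp r∣p)) p∈Σ
... | inj₂ r∣u = unit r pr r∣u

IsΣUnit-coprime : ∀ {Σs m t p} → IsΣUnit Σs m → ∣ t ∣ ∣ ∣ m ∣ → Prime p → p ∉ Σs → Cop.Coprime p ∣ t ∣
IsΣUnit-coprime unit t∣m pp p∉Σ (d∣p , d∣t) with prime⇒irreducible pp d∣p
... | inj₁ d≡1 = d≡1
... | inj₂ refl = ⊥-elim (p∉Σ (unit _ pp (ℕD.∣-trans d∣t t∣m)))

SquareFactorOutside : List ℕ → ℕ → ℕ → Set
SquareFactorOutside Σs m p = Prime p × p ∉ Σs × p ℕ.* p ∣ m

squareFactorOutside? : ∀ Σs m p → Dec (SquareFactorOutside Σs m p)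
squareFactorOutside? Σs m p = prime? p ×-dec ¬? (p ∈? Σs) ×-dec (p ℕ.* p ∣? m)

NoSquareOutside : List ℕ → ℕ → Set
NoSquareOutside Σs m = ∀ p → ¬ SquareFactorOutside Σs m p

NoSquareOutside-∣ : ∀ {Σs m n} → m ∣ n → NoSquareOutside Σs n → NoSquareOutside Σs m
NoSquareOutside-∣ m∣n noSq p (pp , p∉Σ , pp∣m) = noSq p (pp , p∉Σ , ℕD.∣-trans pp∣m m∣n)

-- A non-zero integer with no prime factor in Σ and no square prime factor outside Σ
-- is square-free: a prime factor of d with d² ∣ L would give one of the two.
squareFree-criterion : ∀ Σs L → L ≢ 0ℤ → NoSquareOutside Σs ∣ L ∣ → ¬ Any (_∣ ∣ L ∣) Σs → SquareFree L
squareFree-criterion Σs L L≢0 noSq noΣ d dd∣L = unit ∣ d ∣ (subst (_∣ ∣ L ∣) (ℤP.abs-* d d) dd∣L)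
  where
  unit : ∀ m → m ℕ.* m ∣ ∣ L ∣ → m ≡ 1
  unit 0 0∣L = ⊥-elim (L≢0 (ℤP.∣i∣≡0⇒i≡0 (ℕD.0∣⇒≡0 0∣L)))
  unit 1 _   = refl
  unit m@(suc (suc _)) mm∣L = ⊥-elim (noPrimeFactor (primeFactor m (s≤s (s≤s z≤n))))
    where
    noPrimeFactor : ∃[ r ] (Prime r × r ∣ m) → ⊥
    noPrimeFactor (r , pr , r∣m) with r ∈? Σs | ℕD.∣-trans (ℕD.*-pres-∣ r∣m r∣m) mm∣L
    ... | yes r∈Σ | rr∣L = noΣ (Any.map (λ { refl → ℕD.∣-trans (ℕD.m∣m*n r) rr∣L }) r∈Σ)
    ... | no  r∉Σ | rr∣L = noSq r (pr , r∉Σ , rr∣L)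

divideOut : ∀ {p L} → Prime p → p ∣ ∣ L ∣ → L ≢ 0ℤ → ∃[ q ] (L ≡ q ℤ.* + p × q ≢ 0ℤ × ∣ q ∣ ℕ.< ∣ L ∣)
divideOut {p} {L} pp p∣L L≢0 = q , L≡qp , q≢0 , q<L
  where
  open ℤS._∣_ (ℤS.∣ᵤ⇒∣ {+ p} {L} p∣L) renaming (quotient to q; equality to L≡qp)
  q≢0 : q ≢ 0ℤ
  q≢0 q≡0 = L≢0 (trans L≡qp (cong (ℤ._* + p) q≡0))
  q<L : ∣ q ∣ ℕ.< ∣ L ∣
  q<L = begin-strict
    ∣ q ∣             ≡⟨ ℕP.*-identityʳ ∣ q ∣ ⟨
    ∣ q ∣ ℕ.* 1       <⟨ ℕP.*-monoʳ-< ∣ q ∣ {{ℕ.≢-nonZero (λ e → q≢0 (ℤP.∣i∣≡0⇒i≡0 e))}} (prime≥2 pp) ⟩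
    ∣ q ∣ ℕ.* p       ≡⟨ ℤP.abs-* q (+ p) ⟨
    ∣ q ℤ.* + p ∣     ≡⟨ cong ∣_∣ L≡qp ⟨
    ∣ L ∣             ∎
    where open ℕP.≤-Reasoning

-- A non-zero integer without square prime factors outside Σ is Σ-square-free: divide out
-- the primes of Σ one at a time (induction on ∣L∣) and finish with squareFree-criterion.
ΣSquareFree-criterion : ∀ Σs → All Prime Σs → ∀ L → L ≢ 0ℤ → NoSquareOutside Σs ∣ L ∣ → IsΣSquareFree Σs L
ΣSquareFree-criterion Σs Σp L = go L (<-wellFounded ∣ L ∣)
  where
  go : ∀ L → Acc ℕ._<_ ∣ L ∣ → L ≢ 0ℤ → NoSquareOutside Σs ∣ L ∣ → IsΣSquareFree Σs L
  go L (acc smaller) L≢0 noSq with any? (_∣? ∣ L ∣) Σs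
  ... | no noΣ = + 1 , L , IsΣUnit-1 Σs , squareFree-criterion Σs L L≢0 noSq noΣ , sym (ℤP.*-identityˡ L)
  ... | yes someΣ with find someΣ
  ...   | p , p∈Σ , p∣L with divideOut (All.lookup Σp p∈Σ) p∣L L≢0
  ...     | q , refl , q≢0 , q<L with go q (smaller q<L) q≢0 (NoSquareOutside-∣ q∣L noSq)
    where
    q∣L : ∣ q ∣ ∣ ∣ q ℤ.* + p ∣
    q∣L = subst (∣ q ∣ ∣_) (sym (ℤP.abs-* q (+ p))) (ℕD.m∣m*n p)
  ...       | u , s , unit , sqf , refl =
    + p ℤ.* u , s , IsΣUnit-*prime p∈Σ (All.lookup Σp p∈Σ) unit , sqf ,
    trans (ℤP.*-comm (u ℤ.* s) (+ p)) (sym (ℤP.*-assoc (+ p) u s))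

-- Consequently an integer that is not Σ-square-free is 0 or is non-zero and divisible by p²
-- for a prime p ∉ Σ (found by a bounded search, since such a p is at most ∣L∣).
notΣSquareFree⇒square : ∀ Σs → All Prime Σs → ∀ L → ¬ IsΣSquareFree Σs L →
  L ≡ 0ℤ ⊎ (L ≢ 0ℤ × ∃[ p ] SquareFactorOutside Σs ∣ L ∣ p)
notΣSquareFree⇒square Σs Σp L notSF with L ℤ.≟ 0ℤ
... | yes L≡0 = inj₁ L≡0
... | no L≢0  = inj₂ (L≢0 , search (any? (squareFactorOutside? Σs ∣ L ∣) (upTo (suc ∣ L ∣))))
  where
  L≢0ℕ : ∣ L ∣ ≢ 0
  L≢0ℕ e = L≢0 (ℤP.∣i∣≡0⇒i≡0 e)
  bounded : ∀ p → SquareFactorOutside Σs ∣ L ∣ p → p ∈ upTo (suc ∣ L ∣)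
  bounded p (pp , _ , pp∣L) = ∈-upTo⁺ (s≤s (ℕP.≤-trans p≤pp (ℕD.∣⇒≤ {{ℕ.≢-nonZero L≢0ℕ}} pp∣L)))
    where
    p≤pp : p ≤ p ℕ.* p
    p≤pp = ℕP.m≤m*n p p {{prime⇒nonZero pp}}
  search : Dec (Any (SquareFactorOutside Σs ∣ L ∣) (upTo (suc ∣ L ∣))) →
           ∃[ p ] SquareFactorOutside Σs ∣ L ∣ p
  search (yes found) = proj₁ (find found) , proj₂ (proj₂ (find found))
  search (no none)   = ⊥-elim (notSF (ΣSquareFree-criterion Σs Σp L L≢0 noSquare))
    where
    noSquare : NoSquareOutside Σs ∣ L ∣
    noSquare p sq = none (Any.map (λ { refl → sq }) (bounded p sq))

∈⇒∣productℤ : ∀ {x xs} → x ∈ xs → ∣ x ∣ ∣ ∣ foldr ℤ._*_ (+ 1) xs ∣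
∈⇒∣productℤ {xs = y ∷ ys} x∈xs rewrite ℤP.abs-* y (foldr ℤ._*_ (+ 1) ys) with x∈xs
... | here refl  = ℕD.m∣m*n _
... | there x∈ys = ℕD.∣n⇒∣m*n ∣ y ∣ (∈⇒∣productℤ x∈ys)

∣prodFin : ∀ {k} (f : Fin k → ℤ) i → ∣ f i ∣ ∣ ∣ prodFin f ∣
∣prodFin f i = ∈⇒∣productℤ (∈-map⁺ f (∈-allFin i))

∣PΣ : ∀ Σs z p → Prime p → p ∉ Σs → ℕtoℚ p ℚ.< z → p ∣ PΣ Σs z
∣PΣ Σs z p pp p∉Σ p<z with natBelowFloor p z (ℚP.<⇒≤ p<z)
... | F , floor≡F , p≤F =
  ∈⇒∣product (∈-filter⁺ (λ p → prime? p ×-dec ¬? (p ∈? Σs) ×-dec (ℕtoℚ p ℚP.<? z))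
                         (∈-upTo⁺ (s≤s (subst (λ t → p ≤ ∣ t ∣) (sym floor≡F) p≤F)))
                         (pp , p∉Σ , p<z))

-- The sieve condition: for n ∈ Ω(x,z), a prime p ∉ Σ dividing some L_i(n) is at least z,
-- since otherwise it would divide gcd(L_1(n)⋯L_k(n), P_Σ(z)) = 1.
Ω-primeFactor≥z : ∀ Σs {k} (a b : Fin k → ℤ) x z n → InΩ Σs a b x z n →
  ∀ i p → Prime p → p ∉ Σs → p ∣ ∣ Lform a b i n ∣ → z ℚ.≤ ℕtoℚ p
Ω-primeFactor≥z Σs a b x z n (_ , _ , gcd≡1) i p pp p∉Σ p∣L = ℚP.≮⇒≥ p≮z
  where
  L∏ : ℤ
  L∏ = prodFin (λ j → Lform a b j n)
  p≮z : ¬ (ℕtoℚ p ℚ.< z)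
  p≮z p<z = prime∤1 pp (subst (λ t → p ∣ ∣ t ∣) gcd≡1
              (ℤG.gcd-greatest {L∏} {+ PΣ Σs z} {+ p}
                 (ℕD.∣-trans p∣L (∣prodFin (λ j → Lform a b j n) i))
                 (∣PΣ Σs z p pp p∉Σ p<z)))

lookup-injective : ∀ {A : Set} {l : List A} → Unique l → ∀ i j → lookup l i ≡ lookup l j → i ≡ j
lookup-injective (_ ∷ _)     Fin.zero    Fin.zero    _ = refl
lookup-injective (x∉ ∷ _)    Fin.zero    (Fin.suc j) e = ⊥-elim (All.lookup x∉ (∈-lookup j) e)
lookup-injective (x∉ ∷ _)    (Fin.suc i) Fin.zero    e = ⊥-elim (All.lookup x∉ (∈-lookup i) (sym e))
lookup-injective (_ ∷ uniq)  (Fin.suc i) (Fin.suc j) e = cong Fin.suc (lookup-injective uniq i j e)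

length≤-injection : ∀ {A : Set} (l : List A) → Unique l → (g : A → ℕ) (B : ℕ) →
  All (λ x → g x ℕ.< B) l → (∀ {x y} → x ∈ l → y ∈ l → g x ≡ g y → x ≡ y) → length l ≤ B
length≤-injection l uniq g B g<B g-inj with length l ℕP.≤? B
... | yes l≤B = l≤B
... | no  l≰B with FinP.pigeonhole (ℕP.≰⇒> l≰B) (λ i → fromℕ< (All.lookup g<B (∈-lookup i)))
...   | i , j , i<j , gi≡gj = ⊥-elim (FinP.<⇒≢ i<j (lookup-injective uniq i j
          (g-inj (∈-lookup i) (∈-lookup j)
            (trans (sym (FinP.toℕ-fromℕ< _)) (trans (cong toℕ gi≡gj) (FinP.toℕ-fromℕ< _))))))

atMostOneRoot : ∀ (A B : ℤ) → A ≢ 0ℤ → (l : List ℤ) → Unique l →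
  All (λ y → A ℤ.* y ℤ.+ B ≡ 0ℤ) l → length l ≤ 1
atMostOneRoot A B A≢0 []           _                 _            = z≤n
atMostOneRoot A B A≢0 (_ ∷ [])     _                 _            = s≤s z≤n
atMostOneRoot A B A≢0 (y ∷ y' ∷ _) ((y≢y' ∷ _) ∷ _) (r ∷ r' ∷ _) =
  ⊥-elim (y≢y' (ℤP.*-cancelˡ-≡ A y y' {{ℤ.≢-nonZero A≢0}}
                 (+-cancelʳ B (A ℤ.* y) (A ℤ.* y') (trans r (sym r')))))

multiple<⇒0 : ∀ {m t} → m ∣ t → t ℕ.< m → t ≡ 0
multiple<⇒0 {t = zero}  _   _   = refl
multiple<⇒0 {t = suc t} m∣t t<m = ⊥-elim (ℕD.>⇒∤ t<m m∣t)

-- Two numbers v ≤ v' differing by a multiple of m and having the same quotient by m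
-- are equal: their difference is below m.
quotient-injective : ∀ m .{{_ : NonZero m}} v v' → v ≤ v' → m ∣ v' ℕ.∸ v → v / m ≡ v' / m → v ≡ v'
quotient-injective m v v' v≤v' m∣d q≡q' =
  ℕP.≤-antisym v≤v' (ℕP.m∸n≡0⇒m≤n (multiple<⇒0 m∣d d<m))
  where
  open ℕP.≤-Reasoning
  d<m : v' ℕ.∸ v ℕ.< m
  d<m = begin-strict
    v' ℕ.∸ v                   ≤⟨ ℕP.∸-monoʳ-≤ v' (m/n*n≤m v m) ⟩
    v' ℕ.∸ v / m ℕ.* m          ≡⟨ cong (λ q → v' ℕ.∸ q ℕ.* m) q≡q' ⟩
    v' ℕ.∸ v' / m ℕ.* m         ≡⟨ cong (ℕ._∸ v' / m ℕ.* m) (m≡m%n+[m/n]*n v' m) ⟩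
    v' % m ℕ.+ v' / m ℕ.* m ℕ.∸ v' / m ℕ.* m ≡⟨ ℕP.m+n∸n≡m (v' % m) (v' / m ℕ.* m) ⟩
    v' % m                     <⟨ m%n<n v' m ⟩
    m                          ∎

InRange : ℕ → ℤ → Set
InRange X n = + 1 ℤ.≤ n × n ℤ.≤ + X

solutions-congruent : ∀ (A B : ℤ) m → (∀ t → m ∣ ∣ A ∣ ℕ.* t → m ∣ t) → ∀ u u' → u ≤ u' →
  m ∣ ∣ A ℤ.* + u ℤ.+ B ∣ → m ∣ ∣ A ℤ.* + u' ℤ.+ B ∣ → m ∣ u' ℕ.∸ u
solutions-congruent A B m invertible u u' u≤u' m∣Lu m∣Lu' = invertible (u' ℕ.∸ u) m∣A[u'-u]
  where
  difference : ∀ A B u u' → (A ℤ.* u' ℤ.+ B) ℤ.- (A ℤ.* u ℤ.+ B) ≡ A ℤ.* (u' ℤ.- u)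
  difference = solve-∀
  ∣u'-u∣ : ∣ + u' ℤ.- + u ∣ ≡ u' ℕ.∸ u
  ∣u'-u∣ = cong ∣_∣ (trans (ℤP.[+m]-[+n]≡m⊖n u' u) (ℤP.⊖-≥ u≤u'))
  m∣A[u'-u] : m ∣ ∣ A ∣ ℕ.* (u' ℕ.∸ u)
  m∣A[u'-u] = subst (m ∣_) (trans (cong ∣_∣ (difference A B (+ u) (+ u'))) (trans (ℤP.abs-* A _) (cong (∣ A ∣ ℕ.*_) ∣u'-u∣)))
                (ℤS.∣⇒∣ᵤ (ℤS.∣m∣n⇒∣m-n (ℤS.∣ᵤ⇒∣ {+ m} {A ℤ.* + u' ℤ.+ B} m∣Lu') (ℤS.∣ᵤ⇒∣ {+ m} {A ℤ.* + u ℤ.+ B} m∣Lu)))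

-- Hence the solutions u ∈ [1, X] of m ∣ A·u + B are determined by ⌊(u-1)/m⌋ ≤ ⌊X/m⌋,
-- so there are at most ⌊X/m⌋ + 1 of them.
residueClassCount : ∀ (A B : ℤ) m .{{_ : NonZero m}} X → (∀ t → m ∣ ∣ A ∣ ℕ.* t → m ∣ t) →
  (l : List ℤ) → Unique l →
  All (λ y → InRange X y × m ∣ ∣ A ℤ.* y ℤ.+ B ∣) l → length l ≤ X / m ℕ.+ 1
residueClassCount A B m X invertible l uniq sols =
  ℕP.≤-trans (length≤-injection l uniq block (suc (X / m)) (All.map block< sols) block-injective)
             (ℕP.≤-reflexive (ℕP.+-comm 1 (X / m)))
  where
  block : ℤ → ℕ
  block y = (∣ y ∣ ℕ.∸ 1) / m
  block< : ∀ {y} → InRange X y × m ∣ ∣ A ℤ.* y ℤ.+ B ∣ → block y ℕ.< suc (X / m)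
  block< ((ℤ.+≤+ _ , ℤ.+≤+ u≤X) , _) = s≤s (/-monoˡ-≤ m (ℕP.≤-trans (ℕP.m∸n≤m _ 1) u≤X))
  same-block : ∀ v v' → v ≤ v' → m ∣ ∣ A ℤ.* + suc v ℤ.+ B ∣ → m ∣ ∣ A ℤ.* + suc v' ℤ.+ B ∣ →
               v / m ≡ v' / m → + suc v ≡ + suc v'
  same-block v v' v≤v' m∣L m∣L' eq = cong (λ w → + suc w)
    (quotient-injective m v v' v≤v' (solutions-congruent A B m invertible (suc v) (suc v') (s≤s v≤v') m∣L m∣L') eq)
  block-injective : ∀ {y y'} → y ∈ l → y' ∈ l → block y ≡ block y' → y ≡ y'
  block-injective y∈l y'∈l with All.lookup sols y∈l | All.lookup sols y'∈l
  ... | (ℤ.+≤+ {n = suc v} _ , _) , m∣L | (ℤ.+≤+ {n = suc v'} _ , _) , m∣L' with ℕP.≤-total v v'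
  ...   | inj₁ v≤v' = λ eq → same-block v v' v≤v' m∣L m∣L' eq
  ...   | inj₂ v'≤v = λ eq → sym (same-block v' v v'≤v m∣L' m∣L (sym eq))

module _ {A I : Set} {P : I → A → Set} (P? : ∀ j → Decidable (P j)) where

  countOver : List I → List A → ℕ
  countOver J l = sum (map (λ j → length (filter (P? j) l)) J)

  private
    filter-∷-≥ : ∀ j x xs → length (filter (P? j) xs) ≤ length (filter (P? j) (x ∷ xs))
    filter-∷-≥ j x xs with P? j x
    ... | yes _ = ℕP.n≤1+n _
    ... | no  _ = ℕP.≤-refl

    countOver-∷-≥ : ∀ J x xs → countOver J xs ≤ countOver J (x ∷ xs)
    countOver-∷-≥ []      x xs = z≤n
    countOver-∷-≥ (j ∷ J) x xs = ℕP.+-mono-≤ (filter-∷-≥ j x xs) (countOver-∷-≥ J x xs)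

    countOver-∷-> : ∀ J x xs → Any (λ j → P j x) J → countOver J xs ℕ.< countOver J (x ∷ xs)
    countOver-∷-> (j ∷ J) x xs (here Pjx) rewrite filter-accept (P? j) {x} {xs} Pjx =
      s≤s (ℕP.+-monoʳ-≤ (length (filter (P? j) xs)) (countOver-∷-≥ J x xs))
    countOver-∷-> (j ∷ J) x xs (there any) =
      ℕP.≤-trans (ℕP.≤-reflexive (sym (ℕP.+-suc _ _)))
                 (ℕP.+-mono-≤ (filter-∷-≥ j x xs) (countOver-∷-> J x xs any))

  union-bound : ∀ J l → All (λ x → Any (λ j → P j x) J) l → length l ≤ countOver J l
  union-bound J []       []           = z≤n
  union-bound J (x ∷ xs) (any ∷ anys) = ℕP.≤-trans (s≤s (union-bound J xs anys)) (countOver-∷-> J x xs any)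

-- ⌊X/d²⌋, with the harmless convention ⌊X/0⌋ = 0.
divSq : ℕ → ℕ → ℕ
divSq X zero    = 0
divSq X (suc d) = X / (suc d ℕ.* suc d)

squareModuli : ℕ → ℕ → ℕ → List ℕ
squareModuli Z zero       V = []
squareModuli Z (suc fuel) V with Z ℕ.* Z ℕP.≤? V
... | yes _ = Z ∷ squareModuli (suc Z) fuel V
... | no  _ = []

-- All moduli d ≥ Z with d² ≤ V (at most V+1 of them can qualify).
moduliUpTo : ℕ → ℕ → List ℕ
moduliUpTo Z V = squareModuli Z (suc V) V

-- Every d ≥ Z with d² ≤ V inside the scanned range is listed (the scan only stops at a
-- modulus whose square exceeds V).
∈-squareModuli : ∀ fuel Z V d → Z ≤ d → d ℕ.* d ≤ V → d ℕ.∸ Z ℕ.< fuel → d ∈ squareModuli Z fuel V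
∈-squareModuli (suc fuel) Z V d Z≤d dd≤V d-Z<fuel with Z ℕ.* Z ℕP.≤? V
... | no  ZZ≰V = ⊥-elim (ZZ≰V (ℕP.≤-trans (ℕP.*-mono-≤ Z≤d Z≤d) dd≤V))
... | yes _ with ℕP.m≤n⇒m<n∨m≡n Z≤d
...   | inj₂ refl = here refl
...   | inj₁ Z<d  = there (∈-squareModuli fuel (suc Z) V d Z<d dd≤V
          (ℕP.≤-pred (ℕP.≤-trans (s≤s (ℕP.≤-reflexive (sym (ℕP.+-∸-assoc 1 Z<d)))) d-Z<fuel)))

-- One telescoping step of Σ_{d ≥ Z} ⌊X/d²⌋ ≤ X/(Z-1) (via 1/d² ≤ 1/(d-1) - 1/d):
-- with Z = y+1, q·Z² ≤ X and T·Z ≤ X give (q+T)·y ≤ X.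
telescoping-step : ∀ X q T y → q ℕ.* (suc y ℕ.* suc y) ≤ X → T ℕ.* suc y ≤ X → (q ℕ.+ T) ℕ.* y ≤ X
telescoping-step X q T y qZ²≤X TZ≤X = ℕP.*-cancelʳ-≤ ((q ℕ.+ T) ℕ.* y) X (suc y ℕ.* suc y) (begin
  (q ℕ.+ T) ℕ.* y ℕ.* (suc y ℕ.* suc y)
    ≡⟨ split q T y ⟩
  q ℕ.* (suc y ℕ.* suc y) ℕ.* y ℕ.+ T ℕ.* suc y ℕ.* (y ℕ.* suc y)
    ≤⟨ ℕP.+-mono-≤ (ℕP.*-monoˡ-≤ y qZ²≤X) (ℕP.*-monoˡ-≤ (y ℕ.* suc y) TZ≤X) ⟩
  X ℕ.* y ℕ.+ X ℕ.* (y ℕ.* suc y)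
    ≡⟨ ℕP.*-distribˡ-+ X y (y ℕ.* suc y) ⟨
  X ℕ.* (y ℕ.+ y ℕ.* suc y)
    ≤⟨ ℕP.*-monoʳ-≤ X (ℕP.≤-trans (ℕP.n≤1+n _) (ℕP.≤-reflexive (square y))) ⟩
  X ℕ.* (suc y ℕ.* suc y) ∎)
  where
  open ℕP.≤-Reasoning
  split : ∀ q T y → (q ℕ.+ T) ℕ.* y ℕ.* (suc y ℕ.* suc y) ≡
                    q ℕ.* (suc y ℕ.* suc y) ℕ.* y ℕ.+ T ℕ.* suc y ℕ.* (y ℕ.* suc y)
  split = ℕSolver.solve-∀
  square : ∀ y → suc (y ℕ.+ y ℕ.* suc y) ≡ suc y ℕ.* suc y
  square = ℕSolver.solve-∀

squareModuli-telescoping : ∀ fuel Z X V → sum (map (divSq X) (squareModuli Z fuel V)) ℕ.* (Z ℕ.∸ 1) ≤ X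
squareModuli-telescoping zero       Z       X V = z≤n
squareModuli-telescoping (suc fuel) zero    X V =
  subst (_≤ X) (sym (ℕP.*-zeroʳ (sum (map (divSq X) (squareModuli 0 (suc fuel) V))))) z≤n
squareModuli-telescoping (suc fuel) (suc y) X V with suc y ℕ.* suc y ℕP.≤? V
... | yes _ = telescoping-step X (divSq X (suc y)) _ y (m/n*n≤m X (suc y ℕ.* suc y))
                (squareModuli-telescoping fuel (suc (suc y)) X V)
... | no  _ = z≤n

squareModuli-empty : ∀ fuel Z V → ¬ (Z ℕ.* Z ≤ V) → squareModuli Z fuel V ≡ []
squareModuli-empty zero       Z V _ = refl
squareModuli-empty (suc fuel) Z V ZZ≰V with Z ℕ.* Z ℕP.≤? V
... | yes ZZ≤V = ⊥-elim (ZZ≰V ZZ≤V)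
... | no  _    = refl

lastModulus-square≤ : ∀ fuel y V → y ℕ.* y ≤ V →
  let E = length (squareModuli (suc y) fuel V) in (y ℕ.+ E) ℕ.* (y ℕ.+ E) ≤ V
lastModulus-square≤ zero       y V yy≤V = subst (λ t → t ℕ.* t ≤ V) (sym (ℕP.+-identityʳ y)) yy≤V
lastModulus-square≤ (suc fuel) y V yy≤V with suc y ℕ.* suc y ℕP.≤? V
... | yes y'y'≤V = subst (λ t → t ℕ.* t ≤ V) (sym (ℕP.+-suc y _)) (lastModulus-square≤ fuel (suc y) V y'y'≤V)
... | no  _      = subst (λ t → t ℕ.* t ≤ V) (sym (ℕP.+-identityʳ y)) yy≤V

squareModuli-length : ∀ fuel Z V → 2 ≤ Z → 1 ≤ V →
  let E = length (squareModuli Z fuel V) in suc E ℕ.* suc E ≤ V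
squareModuli-length fuel (suc y) V (s≤s 1≤y) 1≤V with y ℕ.* y ℕP.≤? V
... | yes yy≤V = ℕP.≤-trans (ℕP.*-mono-≤ E+1≤y+E E+1≤y+E) (lastModulus-square≤ fuel y V yy≤V)
  where
  E+1≤y+E : suc (length (squareModuli (suc y) fuel V)) ≤ y ℕ.+ length (squareModuli (suc y) fuel V)
  E+1≤y+E = ℕP.+-monoˡ-≤ _ 1≤y
... | no  yy≰V rewrite squareModuli-empty fuel (suc y) V
                         (λ y'y'≤V → yy≰V (ℕP.≤-trans (ℕP.*-mono-≤ (ℕP.n≤1+n y) (ℕP.n≤1+n y)) y'y'≤V)) = 1≤V

sum-map-mono : ∀ {I : Set} (f g : I → ℕ) → (∀ j → f j ≤ g j) → ∀ J → sum (map f J) ≤ sum (map g J)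
sum-map-mono f g f≤g []      = z≤n
sum-map-mono f g f≤g (j ∷ J) = ℕP.+-mono-≤ (f≤g j) (sum-map-mono f g f≤g J)

sum-map-const : ∀ {I : Set} (C : ℕ) (J : List I) → sum (map (λ _ → C) J) ≡ length J ℕ.* C
sum-map-const C []      = refl
sum-map-const C (_ ∷ J) = cong (C ℕ.+_) (sum-map-const C J)

sum-map-+1 : ∀ {I : Set} (f : I → ℕ) (J : List I) → sum (map (λ j → f j ℕ.+ 1) J) ≡ sum (map f J) ℕ.+ length J
sum-map-+1 f []      = refl
sum-map-+1 f (j ∷ J) = begin
  f j ℕ.+ 1 ℕ.+ sum (map (λ j → f j ℕ.+ 1) J) ≡⟨ cong (f j ℕ.+ 1 ℕ.+_) (sum-map-+1 f J) ⟩
  f j ℕ.+ 1 ℕ.+ (sum (map f J) ℕ.+ length J)   ≡⟨ rearrange (f j) (sum (map f J)) (length J) ⟩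
  f j ℕ.+ sum (map f J) ℕ.+ suc (length J)     ∎
  where
  open ≡-Reasoning
  rearrange : ∀ a s l → a ℕ.+ 1 ℕ.+ (s ℕ.+ l) ≡ a ℕ.+ s ℕ.+ suc l
  rearrange = ℕSolver.solve-∀

square-coprime-divisor : ∀ d .{{_ : NonZero d}} A → Cop.Coprime d A → ∀ t → d ℕ.* d ∣ A ℕ.* t → d ℕ.* d ∣ t
square-coprime-divisor d A cop t dd∣At with Cop.coprime-divisor cop (ℕD.∣-trans (ℕD.m∣m*n d) dd∣At)
... | ℕD.divides s refl = ℕD.*-monoˡ-∣ d (Cop.coprime-divisor cop (ℕD.*-cancelʳ-∣ d dd∣Asd))
  where
  dd∣Asd : d ℕ.* d ∣ A ℕ.* s ℕ.* d
  dd∣Asd = subst (d ℕ.* d ∣_) (sym (ℕP.*-assoc A s d)) dd∣At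

BadAt : ∀ {k} → (Fin k → ℤ) → (Fin k → ℤ) → Fin k → ℕ → ℤ → Set
BadAt a b i zero    n = Lform a b i n ≡ 0ℤ
BadAt a b i (suc d) n = (suc d ℕ.* suc d ∣ ∣ Lform a b i n ∣) × Cop.Coprime (suc d) ∣ a i ∣

badAt? : ∀ {k} (a b : Fin k → ℤ) i d → Decidable (BadAt a b i d)
badAt? a b i zero    n = Lform a b i n ℤ.≟ 0ℤ
badAt? a b i (suc d) n = (suc d ℕ.* suc d ∣? ∣ Lform a b i n ∣) ×-dec Cop.coprime? (suc d) ∣ a i ∣

badAt-pos : ∀ {k} {a b : Fin k → ℤ} {i d n} → 1 ≤ d → d ℕ.* d ∣ ∣ Lform a b i n ∣ → Cop.Coprime d ∣ a i ∣ →
  BadAt a b i d n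
badAt-pos {d = suc _} _ dd∣L cop = dd∣L , cop

-- For a fixed form and level d, the distinct n ∈ [1,X] that are bad at level d number at
-- most ⌊X/d²⌋ + 1: one root if d = 0 (as a_i ≠ 0), one residue class mod d² otherwise.
level-count : ∀ {k} (a b : Fin k → ℤ) → (∀ i → a i ≢ 0ℤ) → ∀ X i d (l : List ℤ) → Unique l →
  All (InRange X) l → All (BadAt a b i d) l → length l ≤ divSq X d ℕ.+ 1
level-count a b a≢0 X i zero    l uniq _ roots = atMostOneRoot (a i) (b i) (a≢0 i) l uniq roots
level-count a b a≢0 X i (suc d) [] _ _ _ = z≤n
level-count a b a≢0 X i (suc d) l@(_ ∷ _) uniq range bad@((_ , cop) ∷ _) =
  residueClassCount (a i) (b i) (suc d ℕ.* suc d) X (square-coprime-divisor (suc d) ∣ a i ∣ cop)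
    l uniq (All.zipWith (λ { (r , (dd∣L , _)) → r , dd∣L }) (range , bad))

bad-count : ∀ {k} (a b : Fin k → ℤ) → (∀ i → a i ≢ 0ℤ) → ∀ X (ds : List ℕ) (ns : List ℤ) → Unique ns →
  All (InRange X) ns → All (λ n → Any (λ i → Any (λ d → BadAt a b i d n) ds) (allFin k)) ns →
  length ns ≤ k ℕ.* sum (map (λ d → divSq X d ℕ.+ 1) ds)
bad-count {k} a b a≢0 X ds ns uniq range bad = begin
  length ns                        ≤⟨ union-bound badFor? (allFin k) ns bad ⟩
  countOver badFor? (allFin k) ns  ≤⟨ sum-map-mono _ (λ _ → C) per-form (allFin k) ⟩
  sum (map (λ _ → C) (allFin k))   ≡⟨ sum-map-const C (allFin k) ⟩
  length (allFin k) ℕ.* C          ≡⟨ cong (ℕ._* C) (length-tabulate {n = k} (λ i → i)) ⟩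
  k ℕ.* C                          ∎
  where
  open ℕP.≤-Reasoning
  C : ℕ
  C = sum (map (λ d → divSq X d ℕ.+ 1) ds)
  BadFor : Fin k → ℤ → Set
  BadFor i n = Any (λ d → BadAt a b i d n) ds
  badFor? : ∀ i → Decidable (BadFor i)
  badFor? i n = any? (λ d → badAt? a b i d n) ds
  per-form : ∀ i → length (filter (badFor? i) ns) ≤ C
  per-form i = ℕP.≤-trans (union-bound (badAt? a b i) ds li (all-filter (badFor? i) ns))
                 (sum-map-mono _ (λ d → divSq X d ℕ.+ 1) per-level ds)
    where
    li : List ℤ
    li = filter (badFor? i) ns
    per-level : ∀ d → length (filter (badAt? a b i d) li) ≤ divSq X d ℕ.+ 1
    per-level d = level-count a b a≢0 X i d (filter (badAt? a b i d) li)
                    (UniqP.filter⁺ (badAt? a b i d) (UniqP.filter⁺ (badFor? i) uniq))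
                    (AllP.filter⁺ (badAt? a b i d) (AllP.filter⁺ (badFor? i) range))
                    (all-filter (badAt? a b i d) li)

*-monoˡ-≤-0≤ : ∀ r {p q} → 0ℚ ℚ.≤ r → p ℚ.≤ q → r ℚ.* p ℚ.≤ r ℚ.* q
*-monoˡ-≤-0≤ r 0≤r = ℚP.*-monoˡ-≤-nonNeg r {{ℚ.nonNegative 0≤r}}

*-monoʳ-≤-0≤ : ∀ r {p q} → 0ℚ ℚ.≤ r → p ℚ.≤ q → p ℚ.* r ℚ.≤ q ℚ.* r
*-monoʳ-≤-0≤ r 0≤r = ℚP.*-monoʳ-≤-nonNeg r {{ℚ.nonNegative 0≤r}}

*-nonNeg : ∀ {p q} → 0ℚ ℚ.≤ p → 0ℚ ℚ.≤ q → 0ℚ ℚ.≤ p ℚ.* q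
*-nonNeg {p} {q} 0≤p 0≤q = ℚP.≤-trans (ℚP.≤-reflexive (sym (ℚP.*-zeroˡ q))) (*-monoʳ-≤-0≤ q 0≤q 0≤p)

square-mono : ∀ {y w} → 0ℚ ℚ.≤ y → y ℚ.≤ w → y ℚ.* y ℚ.≤ w ℚ.* w
square-mono {y} {w} 0≤y y≤w = ℚP.≤-trans (*-monoˡ-≤-0≤ y 0≤y y≤w) (*-monoʳ-≤-0≤ w (ℚP.≤-trans 0≤y y≤w) y≤w)

-- The final estimate over ℚ: if N·c ≤ k(S+B)·c, k·S·c ≤ k·W and k·B² ≤ k·W, then
-- y = N·c − k·W ≤ k·c·B, and y² ≤ (kc)²B² ≤ (kc)²W, i.e. y ≤ k·c·√W (as LeMulSqrt).
leMulSqrt-from-bounds : ∀ (N k S B c W : ℚ) → 0ℚ ℚ.≤ c → 0ℚ ℚ.≤ k →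
  N ℚ.* c ℚ.≤ k ℚ.* (S ℚ.+ B) ℚ.* c → k ℚ.* (S ℚ.* c) ℚ.≤ k ℚ.* W → k ℚ.* (B ℚ.* B) ℚ.≤ k ℚ.* W →
  LeMulSqrt (N ℚ.* c ℚ.- k ℚ.* W) (k ℚ.* c) W
leMulSqrt-from-bounds N k S B c W 0≤c 0≤k Nc≤ kSc≤kW kB²≤kW with (N ℚ.* c ℚ.- k ℚ.* W) ℚP.≤? 0ℚ
... | yes y≤0 = inj₁ y≤0
... | no  y≰0 = inj₂ (ℚP.≤-trans (square-mono (ℚP.<⇒≤ (ℚP.≰⇒> y≰0)) y≤kcB) kcB²≤)
  where
  open +-*-Solver
  open ℚP.≤-Reasoning
  y≤kcB : N ℚ.* c ℚ.- k ℚ.* W ℚ.≤ k ℚ.* c ℚ.* B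
  y≤kcB = begin
    N ℚ.* c ℚ.- k ℚ.* W                                ≤⟨ ℚP.+-monoˡ-≤ (ℚ.- (k ℚ.* W)) Nc≤ ⟩
    k ℚ.* (S ℚ.+ B) ℚ.* c ℚ.- k ℚ.* W                  ≡⟨ solve 5 (λ k S B c kW → k :* (S :+ B) :* c :- kW
                                                            := k :* (S :* c) :+ k :* c :* B :- kW) refl k S B c (k ℚ.* W) ⟩
    k ℚ.* (S ℚ.* c) ℚ.+ k ℚ.* c ℚ.* B ℚ.- k ℚ.* W      ≤⟨ ℚP.+-monoˡ-≤ (ℚ.- (k ℚ.* W)) (ℚP.+-monoˡ-≤ (k ℚ.* c ℚ.* B) kSc≤kW) ⟩
    k ℚ.* W ℚ.+ k ℚ.* c ℚ.* B ℚ.- k ℚ.* W              ≡⟨ solve 2 (λ kW w → kW :+ w :- kW := w) refl (k ℚ.* W) (k ℚ.* c ℚ.* B) ⟩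
    k ℚ.* c ℚ.* B                                      ∎
  kcB²≤ : k ℚ.* c ℚ.* B ℚ.* (k ℚ.* c ℚ.* B) ℚ.≤ k ℚ.* c ℚ.* (k ℚ.* c) ℚ.* W
  kcB²≤ = begin
    k ℚ.* c ℚ.* B ℚ.* (k ℚ.* c ℚ.* B)   ≡⟨ solve 3 (λ k c B → k :* c :* B :* (k :* c :* B)
                                              := c :* c :* k :* (k :* (B :* B))) refl k c B ⟩
    c ℚ.* c ℚ.* k ℚ.* (k ℚ.* (B ℚ.* B)) ≤⟨ *-monoˡ-≤-0≤ (c ℚ.* c ℚ.* k) (*-nonNeg (*-nonNeg 0≤c 0≤c) 0≤k) kB²≤kW ⟩
    c ℚ.* c ℚ.* k ℚ.* (k ℚ.* W)         ≡⟨ solve 3 (λ k c W → c :* c :* k :* (k :* W)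
                                              := k :* c :* (k :* c) :* W) refl k c W ⟩
    k ℚ.* c ℚ.* (k ℚ.* c) ℚ.* W         ∎

sieve-inequality : ∀ (N k S B M X Z : ℕ) (x z : ℚ) →
  ℕtoℚ 1 ℚ.≤ z → z ℚ.≤ ℕtoℚ Z → ℕtoℚ X ℚ.≤ x →
  N ≤ k ℕ.* (S ℕ.+ B) → S ℕ.* (Z ℕ.∸ 1) ≤ X →
  k ℕ.* X ≤ k ℕ.* (M ℕ.* suc X) → k ℕ.* (B ℕ.* B) ≤ k ℕ.* (M ℕ.* suc X) →
  LeMulSqrt (ℕtoℚ N ℚ.* (z ℚ.- ℕtoℚ 1) ℚ.- ℕtoℚ k ℚ.* ℕtoℚ M ℚ.* (x ℚ.+ ℕtoℚ 1))
            (ℕtoℚ k ℚ.* (z ℚ.- ℕtoℚ 1)) (ℕtoℚ M ℚ.* (x ℚ.+ ℕtoℚ 1))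
sieve-inequality N k S B M X Z x z 1≤z z≤Z X≤x N≤ S[Z-1]≤X kX≤ kB²≤ =
  subst (λ t → LeMulSqrt (ℕtoℚ N ℚ.* c ℚ.- t) (ℕtoℚ k ℚ.* c) W) (sym (ℚP.*-assoc (ℕtoℚ k) (ℕtoℚ M) (x ℚ.+ ℕtoℚ 1)))
    (leMulSqrt-from-bounds (ℕtoℚ N) (ℕtoℚ k) (ℕtoℚ S) (ℕtoℚ B) c W 0≤c (ℕtoℚ-nonNeg k)
      Nc≤ kSc≤kW (subst (ℚ._≤ ℕtoℚ k ℚ.* W) (cong (ℕtoℚ k ℚ.*_) (ℕtoℚ-* B B)) (scaled (B ℕ.* B) kB²≤)))
  where
  c : ℚ
  c = z ℚ.- ℕtoℚ 1
  W : ℚ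
  W = ℕtoℚ M ℚ.* (x ℚ.+ ℕtoℚ 1)
  0≤c : 0ℚ ℚ.≤ c
  0≤c = ℚP.≤-trans (ℚP.≤-reflexive (sym (ℚP.+-inverseʳ (ℕtoℚ 1)))) (ℚP.+-monoˡ-≤ (ℚ.- ℕtoℚ 1) 1≤z)
  c≤Z-1 : c ℚ.≤ ℕtoℚ (Z ℕ.∸ 1)
  c≤Z-1 = ℚP.≤-trans (ℚP.+-monoˡ-≤ (ℚ.- ℕtoℚ 1) z≤Z)
            (ℚP.≤-reflexive (sym (ℕtoℚ-pred {Z} (ℕtoℚ-cancel-≤ (ℚP.≤-trans 1≤z z≤Z)))))
  M[X+1]≤W : ℕtoℚ (M ℕ.* suc X) ℚ.≤ W
  M[X+1]≤W = ℚP.≤-trans (ℚP.≤-reflexive (trans (ℕtoℚ-* M (suc X))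
                 (cong (ℕtoℚ M ℚ.*_) (trans (cong ℕtoℚ (ℕP.+-comm 1 X)) (ℕtoℚ-+ X 1)))))
               (*-monoˡ-≤-0≤ (ℕtoℚ M) (ℕtoℚ-nonNeg M) (ℚP.+-monoˡ-≤ (ℕtoℚ 1) X≤x))
  scaled : ∀ m → k ℕ.* m ≤ k ℕ.* (M ℕ.* suc X) → ℕtoℚ k ℚ.* ℕtoℚ m ℚ.≤ ℕtoℚ k ℚ.* W
  scaled m km≤ = ℚP.≤-trans (ℚP.≤-reflexive (sym (ℕtoℚ-* k m)))
                   (ℚP.≤-trans (ℕtoℚ-mono-≤ km≤) (ℚP.≤-trans (ℚP.≤-reflexive (ℕtoℚ-* k (M ℕ.* suc X)))
                     (*-monoˡ-≤-0≤ (ℕtoℚ k) (ℕtoℚ-nonNeg k) M[X+1]≤W)))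
  Nc≤ : ℕtoℚ N ℚ.* c ℚ.≤ ℕtoℚ k ℚ.* (ℕtoℚ S ℚ.+ ℕtoℚ B) ℚ.* c
  Nc≤ = *-monoʳ-≤-0≤ c 0≤c (ℚP.≤-trans (ℕtoℚ-mono-≤ N≤)
          (ℚP.≤-reflexive (trans (ℕtoℚ-* k (S ℕ.+ B)) (cong (ℕtoℚ k ℚ.*_) (ℕtoℚ-+ S B)))))
  Sc≤X : ℕtoℚ S ℚ.* c ℚ.≤ ℕtoℚ X
  Sc≤X = ℚP.≤-trans (*-monoˡ-≤-0≤ (ℕtoℚ S) (ℕtoℚ-nonNeg S) c≤Z-1)
           (ℚP.≤-trans (ℚP.≤-reflexive (sym (ℕtoℚ-* S (Z ℕ.∸ 1)))) (ℕtoℚ-mono-≤ S[Z-1]≤X))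
  kSc≤kW : ℕtoℚ k ℚ.* (ℕtoℚ S ℚ.* c) ℚ.≤ ℕtoℚ k ℚ.* W
  kSc≤kW = ℚP.≤-trans (*-monoˡ-≤-0≤ (ℕtoℚ k) (ℕtoℚ-nonNeg k) Sc≤X) (scaled X kX≤)

∈⇒≤max : ∀ {m ms} → m ∈ ms → m ≤ foldr _⊔_ 0 ms
∈⇒≤max {ms = m ∷ ms} (here refl)  = ℕP.m≤m⊔n m _
∈⇒≤max {ms = m ∷ ms} (there m∈ms) = ℕP.≤-trans (∈⇒≤max m∈ms) (ℕP.m≤n⊔m m _)

max≤ : ∀ {q} ms → 0ℚ ℚ.≤ q → All (λ m → ℕtoℚ m ℚ.≤ q) ms → ℕtoℚ (foldr _⊔_ 0 ms) ℚ.≤ q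
max≤ []       0≤q []            = 0≤q
max≤ {q} (m ∷ ms) 0≤q (m≤q ∷ ms≤q) with ℕP.⊔-sel m (foldr _⊔_ 0 ms)
... | inj₁ max≡m = subst (λ t → ℕtoℚ t ℚ.≤ q) (sym max≡m) m≤q
... | inj₂ max≡r = subst (λ t → ℕtoℚ t ℚ.≤ q) (sym max≡r) (max≤ ms 0≤q ms≤q)

maxFin-≥ : ∀ {k} (f : Fin k → ℕ) i → f i ≤ maxFin f
maxFin-≥ f i = ∈⇒≤max (∈-map⁺ f (∈-allFin i))

positive-range : ∀ (x : ℚ) → 0ℚ ℚ.≤ x → (ns : List ℤ) → All (λ n → + 1 ℤ.≤ n × ℤtoℚ n ℚ.≤ x) ns →
  let X = foldr _⊔_ 0 (map ∣_∣ ns) in All (InRange X) ns × ℕtoℚ X ℚ.≤ x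
positive-range x 0≤x ns bounds =
  All.tabulate (λ n∈ns → inRange (All.lookup bounds n∈ns) (∈⇒≤max (∈-map⁺ ∣_∣ n∈ns))) ,
  max≤ (map ∣_∣ ns) 0≤x (AllP.map⁺ (All.map ∣n∣≤x bounds))
  where
  inRange : ∀ {n X} → + 1 ℤ.≤ n × ℤtoℚ n ℚ.≤ x → ∣ n ∣ ≤ X → InRange X n
  inRange (1≤n@(ℤ.+≤+ _) , _) n≤X = 1≤n , ℤ.+≤+ n≤X
  ∣n∣≤x : ∀ {n} → + 1 ℤ.≤ n × ℤtoℚ n ℚ.≤ x → ℕtoℚ ∣ n ∣ ℚ.≤ x
  ∣n∣≤x (ℤ.+≤+ _ , n≤x) = n≤x

Lform-bound : ∀ (A B : ℤ) M X n → ∣ A ∣ ≤ M → ∣ B ∣ ≤ M → InRange X n → ∣ A ℤ.* n ℤ.+ B ∣ ≤ M ℕ.* suc X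
Lform-bound A B M X (+ u) A≤M B≤M (_ , ℤ.+≤+ u≤X) = begin
  ∣ A ℤ.* + u ℤ.+ B ∣       ≤⟨ ℤP.∣i+j∣≤∣i∣+∣j∣ (A ℤ.* + u) B ⟩
  ∣ A ℤ.* + u ∣ ℕ.+ ∣ B ∣   ≡⟨ cong (ℕ._+ ∣ B ∣) (ℤP.abs-* A (+ u)) ⟩
  ∣ A ∣ ℕ.* u ℕ.+ ∣ B ∣     ≤⟨ ℕP.+-mono-≤ (ℕP.*-mono-≤ A≤M u≤X) B≤M ⟩
  M ℕ.* X ℕ.+ M             ≡⟨ trans (ℕP.+-comm (M ℕ.* X) M) (sym (ℕP.*-suc M X)) ⟩
  M ℕ.* suc X               ∎
  where open ℕP.≤-Reasoning

ΣUnit-factor-coprime : ∀ {Σs k} (a : Fin k → ℤ) c e → IsΣUnit Σs (c ℤ.* prodFin a ℤ.* e) →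
  ∀ i p → Prime p → p ∉ Σs → Cop.Coprime p ∣ a i ∣
ΣUnit-factor-coprime a c e unit i p = IsΣUnit-coprime {m = c ℤ.* prodFin a ℤ.* e} {t = a i} {p = p} unit ai∣unit
  where
  ai∣unit : ∣ a i ∣ ∣ ∣ c ℤ.* prodFin a ℤ.* e ∣
  ai∣unit = subst (∣ a i ∣ ∣_)
              (sym (trans (ℤP.abs-* (c ℤ.* prodFin a) e) (cong (ℕ._* ∣ e ∣) (ℤP.abs-* c (prodFin a)))))
              (ℕD.∣m⇒∣m*n ∣ e ∣ (ℕD.∣n⇒∣m*n ∣ c ∣ (∣prodFin a i)))

Ω-badLevel : ∀ Σs → All Prime Σs → ∀ {k} (a b : Fin k → ℤ) →
  (∀ i p → Prime p → p ∉ Σs → Cop.Coprime p ∣ a i ∣) →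
  ∀ x z (Z : LeastNatAbove z) V n → InΩ Σs a b x z n → ∀ i → ¬ IsΣSquareFree Σs (Lform a b i n) →
  ∣ Lform a b i n ∣ ≤ V → Any (λ d → BadAt a b i d n) (0 ∷ moduliUpTo (LeastNatAbove.value Z) V)
Ω-badLevel Σs Σp a b coprime x z Z V n n∈Ω i notSF L≤V =
  fromDichotomy (notΣSquareFree⇒square Σs Σp (Lform a b i n) notSF)
  where
  Zv : ℕ
  Zv = LeastNatAbove.value Z
  fromDichotomy : Lform a b i n ≡ 0ℤ ⊎ (Lform a b i n ≢ 0ℤ × ∃[ p ] SquareFactorOutside Σs ∣ Lform a b i n ∣ p) →
                  Any (λ d → BadAt a b i d n) (0 ∷ moduliUpTo Zv V)
  fromDichotomy (inj₁ L≡0) = here L≡0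
  fromDichotomy (inj₂ (L≢0 , p , pp , p∉Σ , pp∣L)) =
    there (lose (∈-squareModuli (suc V) Zv V p Z≤p pp≤V (s≤s p-Z≤V))
                (badAt-pos (ℕP.≤-trans (s≤s z≤n) (prime≥2 pp)) pp∣L (coprime i p pp p∉Σ)))
    where
    p≤pp : p ≤ p ℕ.* p
    p≤pp = ℕP.m≤m*n p p {{prime⇒nonZero pp}}
    pp≤V : p ℕ.* p ≤ V
    pp≤V = ℕP.≤-trans (ℕD.∣⇒≤ {{ℕ.≢-nonZero (λ e → L≢0 (ℤP.∣i∣≡0⇒i≡0 e))}} pp∣L) L≤V
    p-Z≤V : p ℕ.∸ Zv ≤ V
    p-Z≤V = ℕP.≤-trans (ℕP.m∸n≤m p Zv) (ℕP.≤-trans p≤pp pp≤V)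
    Z≤p : Zv ≤ p
    Z≤p = LeastNatAbove.least Z p
            (Ω-primeFactor≥z Σs a b x z n n∈Ω i p pp p∉Σ (ℕD.∣-trans (ℕD.m∣m*n p) pp∣L))

sieve-count : ∀ Σs → All Prime Σs → ∀ k (a b : Fin k → ℤ) → (∀ i → a i ≢ 0ℤ) →
  (∀ i p → Prime p → p ∉ Σs → Cop.Coprime p ∣ a i ∣) →
  ∀ x z (Z : LeastNatAbove z) M X → (∀ i → ∣ a i ∣ ≤ M × ∣ b i ∣ ≤ M) →
  (ns : List ℤ) → Unique ns → All (InRange X) ns →
  All (λ n → InΩ Σs a b x z n × ∃[ i ] ¬ IsΣSquareFree Σs (Lform a b i n)) ns →
  let R = moduliUpTo (LeastNatAbove.value Z) (M ℕ.* suc X) in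
  length ns ≤ k ℕ.* (sum (map (divSq X) R) ℕ.+ suc (length R))
sieve-count Σs Σp k a b a≢0 coprime x z Z M X coeff≤M ns uniq range hyp =
  ℕP.≤-trans (bad-count a b a≢0 X (0 ∷ R) ns uniq range (All.zipWith badSomewhere (range , hyp)))
             (ℕP.≤-reflexive (cong (k ℕ.*_) (trans (cong suc (sum-map-+1 (divSq X) R))
                                                   (sym (ℕP.+-suc _ (length R))))))
  where
  R : List ℕ
  R = moduliUpTo (LeastNatAbove.value Z) (M ℕ.* suc X)
  badSomewhere : ∀ {n} → InRange X n × (InΩ Σs a b x z n × ∃[ i ] ¬ IsΣSquareFree Σs (Lform a b i n)) →
                 Any (λ i → Any (λ d → BadAt a b i d n) (0 ∷ R)) (allFin k)
  badSomewhere {n} (n∈[1,X] , n∈Ω , i , notSF) =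
    Any.map (λ { refl → Ω-badLevel Σs Σp a b coprime x z Z (M ℕ.* suc X) n n∈Ω i notSF
                          (Lform-bound (a i) (b i) M X n (proj₁ (coeff≤M i)) (proj₂ (coeff≤M i)) n∈[1,X]) })
            (∈-allFin i)

*-monoʳ-≤-whenPos : ∀ k {m n} → (1 ≤ k → m ≤ n) → k ℕ.* m ≤ k ℕ.* n
*-monoʳ-≤-whenPos zero        _   = z≤n
*-monoʳ-≤-whenPos k@(suc _) m≤n = ℕP.*-monoʳ-≤ k (m≤n (s≤s z≤n))

maxCoeff-bound : ∀ {k} (a b : Fin k → ℤ) i →
  ∣ a i ∣ ≤ maxFin (λ i → ∣ a i ∣ ⊔ ∣ b i ∣) × ∣ b i ∣ ≤ maxFin (λ i → ∣ a i ∣ ⊔ ∣ b i ∣)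
maxCoeff-bound a b i = ℕP.≤-trans (ℕP.m≤m⊔n ∣ a i ∣ ∣ b i ∣) (maxFin-≥ (λ i → ∣ a i ∣ ⊔ ∣ b i ∣) i) ,
                       ℕP.≤-trans (ℕP.m≤n⊔m ∣ a i ∣ ∣ b i ∣) (maxFin-≥ (λ i → ∣ a i ∣ ⊔ ∣ b i ∣) i)

maxCoeff-pos : ∀ {k} (a b : Fin k → ℤ) → (∀ i → a i ≢ 0ℤ) → 1 ≤ k → 1 ≤ maxFin (λ i → ∣ a i ∣ ⊔ ∣ b i ∣)
maxCoeff-pos a b a≢0 1≤k = ℕP.≤-trans (ℕP.n≢0⇒n>0 (λ e → a≢0 i (ℤP.∣i∣≡0⇒i≡0 e))) (proj₁ (maxCoeff-bound a b i))
  where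
  i : Fin _
  i = fromℕ< 1≤k

proposition3p5 :
  (Σs : List ℕ) → All Prime Σs →
  (k : ℕ) (a b : Fin k → ℤ) →
  (∀ i → a i ≢ 0ℤ) →
  (∀ i → gcdℤ (a i) (b i) ≡ + 1) →
  (∀ i j → i < j → a i ℤ.* b j ℤ.- a j ℤ.* b i ≢ 0ℤ) →
  IsΣUnit Σs (+ ((2 ℕ.* k) !) ℤ.* prodFin a ℤ.* prodPairs (λ i j → a i ℤ.* b j ℤ.- a j ℤ.* b i)) →
  (x z : ℚ) → ℕtoℚ 2 ℚ.≤ z → z ℚ.≤ x →
  (ns : List ℤ) → Unique ns →
  All (λ n → InΩ Σs a b x z n × (∃[ i ] ¬ IsΣSquareFree Σs (Lform a b i n))) ns →
  LeMulSqrt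
    (ℕtoℚ (length ns) ℚ.* (z ℚ.- ℕtoℚ 1)
      ℚ.- ℕtoℚ k ℚ.* ℕtoℚ (maxFin (λ i → ∣ a i ∣ ⊔ ∣ b i ∣)) ℚ.* (x ℚ.+ ℕtoℚ 1))
    (ℕtoℚ k ℚ.* (z ℚ.- ℕtoℚ 1))
    (ℕtoℚ (maxFin (λ i → ∣ a i ∣ ⊔ ∣ b i ∣)) ℚ.* (x ℚ.+ ℕtoℚ 1))
proposition3p5 Σs Σp k a b a≢0 _ _ unit x z 2≤z z≤x ns uniq hyp =
  sieve-inequality (length ns) k S (suc E) M X Z x z 1≤z (LeastNatAbove.above Zc) (proj₂ X-range)
    (sieve-count Σs Σp k a b a≢0 coprime x z Zc M X (maxCoeff-bound a b) ns uniq (proj₁ X-range) hyp)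
    (squareModuli-telescoping (suc V) Z X V) (*-monoʳ-≤-whenPos k X≤V) (*-monoʳ-≤-whenPos k E+1²≤V)
  where
  M : ℕ
  M = maxFin (λ i → ∣ a i ∣ ⊔ ∣ b i ∣)
  coprime : ∀ i p → Prime p → p ∉ Σs → Cop.Coprime p ∣ a i ∣
  coprime = ΣUnit-factor-coprime a (+ ((2 ℕ.* k) !)) (prodPairs (λ i j → a i ℤ.* b j ℤ.- a j ℤ.* b i)) unit
  0≤z : 0ℚ ℚ.≤ z
  0≤z = ℚP.≤-trans (ℕtoℚ-nonNeg 2) 2≤z
  1≤z : ℕtoℚ 1 ℚ.≤ z
  1≤z = ℚP.≤-trans (ℕtoℚ-mono-≤ {1} {2} (s≤s z≤n)) 2≤z
  X : ℕ
  X = foldr _⊔_ 0 (map ∣_∣ ns)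
  X-range : All (InRange X) ns × ℕtoℚ X ℚ.≤ x
  X-range = positive-range x (ℚP.≤-trans 0≤z z≤x) ns (All.map (λ ((1≤n , n≤x , _) , _) → 1≤n , n≤x) hyp)
  Zc : LeastNatAbove z
  Zc = leastNatAbove z 0≤z
  Z V E S : ℕ
  Z = LeastNatAbove.value Zc
  V = M ℕ.* suc X
  E = length (moduliUpTo Z V)
  S = sum (map (divSq X) (moduliUpTo Z V))
  X≤V : 1 ≤ k → X ≤ V
  X≤V 1≤k = ℕP.≤-trans (ℕP.n≤1+n X) (ℕP.m≤n*m (suc X) M {{ℕ.>-nonZero (maxCoeff-pos a b a≢0 1≤k)}})
  E+1²≤V : 1 ≤ k → suc E ℕ.* suc E ≤ V
  E+1²≤V 1≤k = squareModuli-length (suc V) Z V (ℕtoℚ-cancel-≤ (ℚP.≤-trans 2≤z (LeastNatAbove.above Zc)))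
                 (ℕP.*-mono-≤ (maxCoeff-pos a b a≢0 1≤k) (s≤s z≤n))
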